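{- Let $G$ be a braced ribbon-cutting graph such that every two distinct vertices are separated by a ribbon of $G$. A NAC-coloring of $G$ is cartesian if and only if each ribbon of $G$ is monochromatic.
   Context: For a graph $H$, two edges are related if they are opposite edges of a 4-cycle subgraph of $H$; a ribbon of $H$ is an equivalence class of the reflexive–transitive closure of this relation. A ribbon-cutting graph is a connected graph in which every ribbon is an edge cut (its removal disconnects the graph). A braced ribbon-cutting graph is a graph $G=(V_G,E_c\cup E_d)$, where $E_c,E_d$ are non-empty disjoint sets, $(V_G,E_c)$ is a ribbon-cutting graph, and every edge of $E_d$ (a brace) is a diagonal $u_1u_3$ of some 4-cycle $(u_1,u_2,u_3,u_4)$ of $(V_G,E_c)$. The ribbons of $G$ are the sets $r\cup\{u_1u_3\in E_d: \exists\text{ 4-cycle }(u_1,u_2,u_3,u_4)\text{ of }(V_G,E_c)\text{ with }u_1u_2,u_3u_4\in r\}$ for ribbons $r$ of $(V_G,E_c)$. A ribbon $r$ of $G$ separates $x,y$ if they lie in different connected components of $(V_G,(E_c\cup E_d)\setminus r)$. A NAC-coloring of $G$ is a surjective map $\delta:E_G\to\{\text{red},\text{blue}\}$ such that every cycle is monochromatic or contains at least two edges of each color; it is cartesian if no two distinct vertices are connected by both a red path and a blue path. -}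

module Defs where

open import Data.Nat using (ℕ; suc; _≤_)
open import Data.Fin using (Fin; zero; suc; fromℕ; inject₁)
open import Data.Bool using (Bool; true; false)
open import Data.Product using (Σ; ∃; ∃-syntax; _×_; _,_; proj₁; proj₂; swap)
open import Data.Sum using (_⊎_)
open import Relation.Nullary using (¬_)
open import Relation.Binary.PropositionalEquality using (_≡_; _≢_)
open import Relation.Binary.Construct.Closure.ReflexiveTransitive using (Star)
open import Function.Definitions using (Injective)

data Color : Set where
  red blue : Color

-- A finite simple graph: vertices Fin n, edges Fin m, each edge given by
-- its (ordered, but meaning unordered) pair of endpoints; no loops and no
-- two edges with the same set of endpoints.
record SimpleGraph : Set where
  field
    n : ℕ
    m : ℕ
    ends : Fin m → Fin n × Fin n
    loopless : ∀ e → proj₁ (ends e) ≢ proj₂ (ends e)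
    noParallel : ∀ e f → (ends e ≡ ends f ⊎ ends e ≡ swap (ends f)) → e ≡ f

module _ (G : SimpleGraph) where
  open SimpleGraph G

  Vertex : Set
  Vertex = Fin n

  Edge : Set
  Edge = Fin m

  EdgeSet : Set₁
  EdgeSet = Edge → Set

  Joins : Edge → Vertex → Vertex → Set
  Joins e u v = ends e ≡ (u , v) ⊎ ends e ≡ (v , u)

  AllEdges : EdgeSet
  AllEdges _ = Edge

  record Path (S : EdgeSet) (x y : Vertex) : Set where
    field
      len : ℕ
      vs : Fin (suc len) → Vertex
      es : Fin len → Edge
      start : vs zero ≡ x
      end : vs (fromℕ len) ≡ y
      distinct : Injective _≡_ _≡_ vs
      inS : ∀ i → S (es i)
      joins : ∀ i → Joins (es i) (vs (inject₁ i)) (vs (suc i))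

  IsConnected : EdgeSet → Set
  IsConnected S = ∀ x y → Path S x y

  record Cycle : Set where
    field
      len : ℕ
      len≥3 : 3 ≤ len
      vs : Fin (suc len) → Vertex
      es : Fin len → Edge
      closed : vs (fromℕ len) ≡ vs zero
      distinctV : Injective _≡_ _≡_ (λ i → vs (inject₁ i))
      distinctE : Injective _≡_ _≡_ es
      joins : ∀ i → Joins (es i) (vs (inject₁ i)) (vs (suc i))

  IsNAC : (Edge → Color) → Set
  IsNAC δ =
    (∀ c → ∃[ e ] δ e ≡ c)
    × (∀ (C : Cycle) → let open Cycle C in
         (∀ i j → δ (es i) ≡ δ (es j))
         ⊎ ((∃[ i ] ∃[ j ] (i ≢ j × δ (es i) ≡ red × δ (es j) ≡ red))
            × (∃[ i ] ∃[ j ] (i ≢ j × δ (es i) ≡ blue × δ (es j) ≡ blue))))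

  Cartesian : (Edge → Color) → Set
  Cartesian δ = ∀ x y → x ≢ y →
    ¬ (Path (λ e → δ e ≡ red) x y × Path (λ e → δ e ≡ blue) x y)

  module Braced (brace : Edge → Bool) where
    Ec : EdgeSet
    Ec e = brace e ≡ false

    Ed : EdgeSet
    Ed e = brace e ≡ true

    record FourCycle : Set where
      field
        u1 u2 u3 u4 : Vertex
        d12 : u1 ≢ u2
        d13 : u1 ≢ u3
        d14 : u1 ≢ u4
        d23 : u2 ≢ u3
        d24 : u2 ≢ u4
        d34 : u3 ≢ u4
        e12 e23 e34 e41 : Edge
        c12 : Ec e12
        c23 : Ec e23
        c34 : Ec e34
        c41 : Ec e41
        j12 : Joins e12 u1 u2
        j23 : Joins e23 u2 u3
        j34 : Joins e34 u3 u4
        j41 : Joins e41 u4 u1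

    Opposite : Edge → Edge → Set
    Opposite e f = Σ FourCycle λ C → let open FourCycle C in
        (e ≡ e12 × f ≡ e34) ⊎ (e ≡ e34 × f ≡ e12)
      ⊎ (e ≡ e23 × f ≡ e41) ⊎ (e ≡ e41 × f ≡ e23)

    RibbonC : Edge → EdgeSet
    RibbonC e f = Star Opposite e f

    RibbonG : Edge → EdgeSet
    RibbonG e f = RibbonC e f
      ⊎ (Ed f × Σ FourCycle λ C → let open FourCycle C in
           Joins f u1 u3 × RibbonC e e12 × RibbonC e e34)

    IsRibbonCutting : Set
    IsRibbonCutting =
      IsConnected Ec
      × (∀ e → Ec e → ∃[ x ] ∃[ y ] ¬ Path (λ f → Ec f × ¬ RibbonC e f) x y)

    IsBracedRibbonCutting : Set
    IsBracedRibbonCutting =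
      (∃[ e ] Ec e) × (∃[ e ] Ed e) × IsRibbonCutting
      × (∀ d → Ed d → Σ FourCycle λ C → let open FourCycle C in Joins d u1 u3)

    Separates : Edge → Vertex → Vertex → Set
    Separates e x y = ¬ Path (λ f → ¬ RibbonG e f) x y

    EveryPairSeparated : Set
    EveryPairSeparated = ∀ x y → x ≢ y → ∃[ e ] (Ec e × Separates e x y)

    RibbonsMonochromatic : (Edge → Color) → Set
    RibbonsMonochromatic δ =
      ∀ e → Ec e → ∀ f g → RibbonG e f → RibbonG e g → δ f ≡ δ g

module Submission where

-- Two monochromatic paths of different
-- colours between the same distinct vertices are forbidden, so every short
-- configuration is forced to be monochromatic: a triangle (a brace together
-- with two sides of its 4-cycle), and the opposite sides of a 4-cycle (by a
-- case split on the colours of the two remaining sides).  Ribbons of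
-- (V, E_c) are generated by the opposite-sides relation, and every brace of
-- a ribbon of G closes a triangle with one of its edges, so ribbons are
-- monochromatic.
-- (⇐) Let x ≠ y be joined by a red and by a blue path, and take a ribbon
-- separating them.  Being monochromatic, the ribbon misses every edge of
-- the path of the other colour, so that path survives its removal.

open import Defs
open import Data.Bool using (Bool)
import Data.Nat as ℕ
open import Data.Fin using (zero; suc; inject₁; fromℕ)
open import Data.Vec using (Vec; []; _∷_; lookup)
open import Data.Vec.Relation.Unary.All using ([]; _∷_)
open import Data.Vec.Relation.Unary.AllPairs using ([]; _∷_)
open import Data.Vec.Relation.Unary.Unique.Propositional using (Unique)
open import Data.Vec.Relation.Unary.Unique.Propositional.Properties using (lookup-injective)
open import Data.Product using (_,_)
open import Data.Sum using (_⊎_; inj₁; inj₂)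
open import Data.Empty using (⊥-elim)
open import Relation.Nullary using (¬_; Dec; yes; no)
open import Relation.Binary.PropositionalEquality
  using (_≡_; _≢_; refl; sym; trans; ≢-sym)
open import Relation.Binary.Construct.Closure.ReflexiveTransitive using (ε; _◅_)
open import Function.Bundles using (_⇔_; mk⇔)

_≟ᶜ_ : (a b : Color) → Dec (a ≡ b)
red  ≟ᶜ red  = yes refl
red  ≟ᶜ blue = no λ ()
blue ≟ᶜ red  = no λ ()
blue ≟ᶜ blue = yes refl

oneOf : {a b : Color} → a ≢ b → (c : Color) → c ≡ a ⊎ c ≡ b
oneOf {red}  {red}  a≢b _    = ⊥-elim (a≢b refl)
oneOf {red}  {blue} _   red  = inj₁ refl
oneOf {red}  {blue} _   blue = inj₂ refl
oneOf {blue} {red}  _   red  = inj₂ refl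
oneOf {blue} {red}  _   blue = inj₁ refl
oneOf {blue} {blue} a≢b _    = ⊥-elim (a≢b refl)

pigeonhole : (a b c : Color) → a ≡ b ⊎ b ≡ c ⊎ a ≡ c
pigeonhole a b c with a ≟ᶜ b
... | yes a≡b = inj₁ a≡b
... | no a≢b with oneOf a≢b c
...   | inj₁ c≡a = inj₂ (inj₂ (sym c≡a))
...   | inj₂ c≡b = inj₂ (inj₁ (sym c≡b))

joins-sym : (G : SimpleGraph) → ∀ {e u v} → Joins G e u v → Joins G e v u
joins-sym _ (inj₁ p) = inj₂ p
joins-sym _ (inj₂ p) = inj₁ p

module ShortPaths (G : SimpleGraph) {S : EdgeSet G} where

  listedPath : ∀ {k} (vs : Vec (Vertex G) (ℕ.suc k)) (es : Vec (Edge G) k)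
    → Unique vs → (∀ i → S (lookup es i))
    → (∀ i → Joins G (lookup es i) (lookup vs (inject₁ i)) (lookup vs (suc i)))
    → Path G S (lookup vs zero) (lookup vs (fromℕ k))
  listedPath {k} vs es unique inS joins = record
    { len = k ; vs = lookup vs ; es = lookup es ; start = refl ; end = refl
    ; distinct = λ {i} {j} → lookup-injective unique i j
    ; inS = inS ; joins = joins }

  edgePath : ∀ {x y e} → x ≢ y → Joins G e x y → S e → Path G S x y
  edgePath x≢y j s =
    listedPath (_ ∷ _ ∷ []) (_ ∷ []) ((x≢y ∷ []) ∷ [] ∷ [])
      (λ { zero → s }) (λ { zero → j })

  path₂ : ∀ {x y z e f} → Unique (x ∷ y ∷ z ∷ [])
    → Joins G e x y → Joins G f y z → S e → S f → Path G S x z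
  path₂ unique j k s t =
    listedPath (_ ∷ _ ∷ _ ∷ []) (_ ∷ _ ∷ []) unique
      (λ { zero → s ; (suc zero) → t }) (λ { zero → j ; (suc zero) → k })

  path₃ : ∀ {x y z w e f g} → Unique (x ∷ y ∷ z ∷ w ∷ [])
    → Joins G e x y → Joins G f y z → Joins G g z w → S e → S f → S g
    → Path G S x w
  path₃ unique j k l s t u =
    listedPath (_ ∷ _ ∷ _ ∷ _ ∷ []) (_ ∷ _ ∷ _ ∷ []) unique
      (λ { zero → s ; (suc zero) → t ; (suc (suc zero)) → u })
      (λ { zero → j ; (suc zero) → k ; (suc (suc zero)) → l })

  widen : ∀ {T : EdgeSet G} {x y} → (∀ {e} → S e → T e) → Path G S x y → Path G T x y
  widen S⊆T p = record
    { len = len ; vs = vs ; es = es ; start = start ; end = end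
    ; distinct = distinct ; inS = λ i → S⊆T (inS i) ; joins = joins }
    where open Path p

module _ (G : SimpleGraph) where

  Coloured : (Edge G → Color) → Color → EdgeSet G
  Coloured δ c e = δ e ≡ c

  module CartesianColouring (δ : Edge G → Color) (cart : Cartesian G δ) where
    open ShortPaths G

    sameColour : ∀ {x y a c} → x ≢ y
      → Path G (Coloured δ a) x y → Path G (Coloured δ c) x y → a ≡ c
    sameColour {a = red}  {red}  _   _ _ = refl
    sameColour {a = red}  {blue} x≢y p q = ⊥-elim (cart _ _ x≢y (p , q))
    sameColour {a = blue} {red}  x≢y p q = ⊥-elim (cart _ _ x≢y (q , p))
    sameColour {a = blue} {blue} _   _ _ = refl

    triangle : ∀ {u v w e f g} → u ≢ v → u ≢ w → v ≢ w
      → Joins G e u v → Joins G f v w → Joins G g u w → δ g ≡ δ e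
    triangle {e = e} {f} {g} u≢v u≢w v≢w je jf jg with pigeonhole (δ e) (δ f) (δ g)
    ... | inj₁ e≡f = sym (sameColour u≢w
            (path₂ ((u≢v ∷ u≢w ∷ []) ∷ (v≢w ∷ []) ∷ [] ∷ []) je jf refl (sym e≡f))
            (edgePath u≢w jg refl))
    ... | inj₂ (inj₁ f≡g) = sym (sameColour (≢-sym u≢v)
            (edgePath (≢-sym u≢v) (joins-sym G je) refl)
            (path₂ ((v≢w ∷ ≢-sym u≢v ∷ []) ∷ (≢-sym u≢w ∷ []) ∷ [] ∷ [])
                   jf (joins-sym G jg) f≡g refl))
    ... | inj₂ (inj₂ e≡g) = sym e≡g

    module _ (brace : Edge G → Bool) where
      open Braced G brace

      -- Opposite sides e12, e34 of a 4-cycle have the same colour: otherwise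
      -- the sides e23, e41 each take one of the two colours, and in each of
      -- the four cases two monochromatic paths of different colours join
      -- the same two vertices of the cycle.
      oppositeSides : (C : FourCycle) → δ (FourCycle.e12 C) ≡ δ (FourCycle.e34 C)
      oppositeSides C with δ e12 ≟ᶜ δ e34
        where open FourCycle C
      ... | yes same = same
      ... | no differ = ⊥-elim (differ (bySides (oneOf differ (δ e23)) (oneOf differ (δ e41))))
        where
        open FourCycle C
        bySides : δ e23 ≡ δ e12 ⊎ δ e23 ≡ δ e34 → δ e41 ≡ δ e12 ⊎ δ e41 ≡ δ e34
          → δ e12 ≡ δ e34
        bySides (inj₁ b) (inj₁ d) = sameColour (≢-sym d34)
          (path₃ ((≢-sym d14 ∷ ≢-sym d24 ∷ ≢-sym d34 ∷ []) ∷ (d12 ∷ d13 ∷ []) ∷ (d23 ∷ []) ∷ [] ∷ [])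
                 j41 j12 j23 d refl b)
          (edgePath (≢-sym d34) (joins-sym G j34) refl)
        bySides (inj₁ b) (inj₂ d) = sameColour d13
          (path₂ ((d12 ∷ d13 ∷ []) ∷ (d23 ∷ []) ∷ [] ∷ []) j12 j23 refl b)
          (path₂ ((d14 ∷ d13 ∷ []) ∷ (≢-sym d34 ∷ []) ∷ [] ∷ [])
                 (joins-sym G j41) (joins-sym G j34) d refl)
        bySides (inj₂ b) (inj₁ d) = sameColour d24
          (path₂ ((≢-sym d12 ∷ d24 ∷ []) ∷ (d14 ∷ []) ∷ [] ∷ [])
                 (joins-sym G j12) (joins-sym G j41) refl d)
          (path₂ ((d23 ∷ d24 ∷ []) ∷ (d34 ∷ []) ∷ [] ∷ []) j23 j34 b refl)
        bySides (inj₂ b) (inj₂ d) = sameColour (≢-sym d12)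
          (edgePath (≢-sym d12) (joins-sym G j12) refl)
          (path₃ ((d23 ∷ d24 ∷ ≢-sym d12 ∷ []) ∷ (d34 ∷ ≢-sym d13 ∷ []) ∷ (≢-sym d14 ∷ []) ∷ [] ∷ [])
                 j23 j34 j41 b refl d)

      rotate : FourCycle → FourCycle
      rotate C = record
        { u1 = u2 ; u2 = u3 ; u3 = u4 ; u4 = u1
        ; d12 = d23 ; d13 = d24 ; d14 = ≢-sym d12 ; d23 = d34
        ; d24 = ≢-sym d13 ; d34 = ≢-sym d14
        ; e12 = e23 ; e23 = e34 ; e34 = e41 ; e41 = e12
        ; c12 = c23 ; c23 = c34 ; c34 = c41 ; c41 = c12
        ; j12 = j23 ; j23 = j34 ; j34 = j41 ; j41 = j12 }
        where open FourCycle C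

      opposite-sameColour : ∀ {e f} → Opposite e f → δ e ≡ δ f
      opposite-sameColour (C , inj₁ (refl , refl)) = oppositeSides C
      opposite-sameColour (C , inj₂ (inj₁ (refl , refl))) = sym (oppositeSides C)
      opposite-sameColour (C , inj₂ (inj₂ (inj₁ (refl , refl)))) = oppositeSides (rotate C)
      opposite-sameColour (C , inj₂ (inj₂ (inj₂ (refl , refl)))) = sym (oppositeSides (rotate C))

      ribbonC-sameColour : ∀ {e f} → RibbonC e f → δ e ≡ δ f
      ribbonC-sameColour ε = refl
      ribbonC-sameColour (o ◅ r) = trans (opposite-sameColour o) (ribbonC-sameColour r)

      -- Every edge of the ribbon of G through e has the colour of e; a brace
      -- u1u3 shares the colour of the side u1u2 of its 4-cycle.
      ribbonG-sameColour : ∀ {e f} → RibbonG e f → δ f ≡ δ e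
      ribbonG-sameColour (inj₁ r) = sym (ribbonC-sameColour r)
      ribbonG-sameColour (inj₂ (_ , C , j13 , r12 , _)) =
        trans (triangle d12 d13 d23 j12 j23 j13) (sym (ribbonC-sameColour r12))
        where open FourCycle C

  cartesian⇒monochromatic : (brace : Edge G → Bool) (δ : Edge G → Color)
    → Cartesian G δ → Braced.RibbonsMonochromatic G brace δ
  cartesian⇒monochromatic brace δ cart _ _ _ _ rf rg =
    trans (ribbonG-sameColour brace rf) (sym (ribbonG-sameColour brace rg))
    where open CartesianColouring δ cart

  module _ (brace : Edge G → Bool) (δ : Edge G → Color) where
    open Braced G brace

    avoidsRibbon : RibbonsMonochromatic δ → ∀ {e x y a c} → Ec e → δ e ≡ a → c ≢ a
      → Path G (Coloured δ c) x y → Path G (λ f → ¬ RibbonG e f) x y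
    avoidsRibbon mono ec δe≡a c≢a = ShortPaths.widen G λ δf≡c inRibbon →
      c≢a (trans (sym δf≡c) (trans (mono _ ec _ _ inRibbon (inj₁ ε)) δe≡a))

    monochromatic⇒cartesian : EveryPairSeparated → RibbonsMonochromatic δ → Cartesian G δ
    monochromatic⇒cartesian sep mono x y x≢y (redPath , bluePath) with sep x y x≢y
    ... | e , ec , separates with δ e in δe
    ...   | red  = separates (avoidsRibbon mono ec δe (λ ()) bluePath)
    ...   | blue = separates (avoidsRibbon mono ec δe (λ ()) redPath)

lemma4p1 : (G : SimpleGraph) (brace : Edge G → Bool)
    → Braced.IsBracedRibbonCutting G brace
    → Braced.EveryPairSeparated G brace
    → (δ : Edge G → Color) → IsNAC G δ
    → Cartesian G δ ⇔ Braced.RibbonsMonochromatic G brace δ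
lemma4p1 G brace _ sep δ _ =
  mk⇔ (cartesian⇒monochromatic G brace δ) (monochromatic⇒cartesian G brace δ sep)
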